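{- Let $\mathcal{P}$ be a parameterized program and $k>0$. Suppose the function $\mathtt{linear\_int}$ of $\mathcal{P}^{\mathit{lazy}}_k$, when called with actual parameters $u_1,\dots,u_k,v_1,\dots,v_{k-1},i$ (where each $u_j,v_j$ is a shared state of $\mathcal{P}$ and $1\le i\le k$), terminates and returns. If $\widehat{s}$ is the valuation of the global variable $s$ at the return, then $(\langle u_1,\dots,u_i\rangle,\langle v_1,\dots,v_{i-1},\widehat{s}\rangle)$ is a linear interface of $\mathcal{P}$ (of length $i$).
   Context: Parameterized programs. A parameterized program $\mathcal{P}=(S,\mathtt{init},\{P_i\}_{i=1}^n)$ consists of shared variables $S$, a sequential block $\mathtt{init}$ initializing them, and processes $P_1,\dots,P_n$ (sequential, possibly recursive, nondeterministic programs with their own thread-global and local variables, a $\mathtt{main}$ function, and possibly atomic blocks). An execution runs $\mathtt{init}$, then an arbitrary number $m$ of threads $T_1,\dots,T_m$ (thread $T_j$ running process $map(j)$, starting in an initial local state) execute interleaved; a state is $(map,i,s,\sigma_1,\dots,\sigma_m)$ with active thread $T_i$, shared state $s$, and local states $\sigma_j$ (program counter, thread-global and local variables, call stack). A context-switch changes the active thread (not allowed inside an atomic block). Linear interface. For $k$-tuples of shared states $\overline{u}=(u_1,\dots,u_k)$, $\overline{v}=(v_1,\dots,v_k)$, the pair $(\overline{u},\overline{v})$ is a linear interface of length $k$ if there are $m\in\mathbb{N}$, $map:[1,m]\to\{P_1,\dots,P_n\}$ and states $s_i^j=(map,i,x_i^j,\sigma_1^{i,j},\dots,\sigma_m^{i,j})$,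 $t_i^j=(map,i,y_i^j,\gamma_1^{i,j},\dots,\gamma_m^{i,j})$ for $i\in[1,m]$, $j\in[1,k]$ such that for each $i$: $x_1^j=u_j$ and $y_m^j=v_j$ for all $j$; $t_i^j$ is reachable from $s_i^j$ using only local transitions of process $map(i)$; $\sigma_i^{i,1}$ is an initial local state of $map(i)$; $\sigma_i^{i,j+1}=\gamma_i^{i,j}$ for $j\in[1,k-1]$; and for $i<m$, $x_{i+1}^j=y_i^j$ and $(t_i^j,s_{i+1}^j)$ is a context-switch. Construction of $\mathcal{P}^{\mathit{lazy}}_k$. The processes are merged into a single process $P$ that nondeterministically chooses at the start which $P_i$ to behave as; functions with return values are replaced by void functions passing values through thread-global variables. Let $s$ be the shared variables and $g$ the global variables of $P$. $\mathcal{P}^{\mathit{lazy}}_k$ has global variables $s$, $g$, and Booleans $\mathit{atom},\mathit{terminate}$. Its $\mathtt{main}$ has locals $q_1,\dots,q_k$ and $i:=1$; it sets $\mathit{atom}:=F$, calls $\mathtt{init}$, sets $q_1$ to the current shared state, and while $i\le k$: sets $\mathit{terminate}:=F$, calls $\mathtt{linear\_int}(q_1,\dots,q_k,q_2,\dots,q_k,i)$, increments $i$, and if $i\le k$ sets $q_i:=s$. The function $\mathtt{linear\_int}(q_1,\dots,q_k,q'_1,\dots,q'_{k-1},\mathit{bound})$ is the body of $P$'s $\mathtt{main}$, starting from an initial local state of $P$ with shared state $q_1$, with a local Boolean $\mathit{last}$ assigned nondeterministically at entry, a local counter $j:=1$, and a local $\mathit{save}$; functions $f$ of $P$ become $f^{\mathit{lazy}}$;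 $\mathit{atom}$ is set to $T$/$F$ on entering/leaving atomic blocks; every original return statement of $\mathtt{linear\_int}$ is preceded by $\mathtt{assume}(F)$. Between every two statements of $\mathtt{linear\_int}$ and of each $f^{\mathit{lazy}}$ the following code is inserted: if $\mathit{terminate}$ then return; if $\neg\mathit{atom}$ then, while $(*)$: if $\mathit{last}$ then { if $j=\mathit{bound}$ then $\mathit{terminate}:=T$, return; else $\mathtt{assume}(q'_j=s)$; $j$++; $s:=q_j$ } else { $q_j:=s$; $\mathit{save}:=g$; call $\mathtt{linear\_int}(q_1,\dots,q_k,q'_1,\dots,q'_{k-1},j)$; if $j=\mathit{bound}$ then return; else $\mathtt{assume}(q'_j=s)$; $g:=\mathit{save}$; $\mathit{terminate}:=F$; $j$++; $s:=q_j$ }. -}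

module Defs where

open import Data.Nat using (ℕ; zero; suc; _<_; _≤_)
open import Data.Fin using (Fin; toℕ; fromℕ; fromℕ<; inject≤)
import Data.Fin as Fin
open import Data.Fin.Properties using (toℕ<n; toℕ≤pred[n])
open import Data.Vec using (Vec; lookup; _[_]≔_; tabulate; _∷ʳ_)
open import Data.Bool using (Bool; true; false)
open import Data.Product using (Σ; ∃; _×_; _,_)
open import Relation.Binary.PropositionalEquality using (_≡_; _≢_)
open import Relation.Nullary using (¬_)
open import Relation.Binary.Construct.Closure.ReflexiveTransitive using (Star)

-- Each process has a
-- type of local states (program counter, thread-global and local
-- variables, call stack), a set of initial local states, a local
-- transition relation on (shared state , local state) pairs (one
-- statement of the process), and a predicate "inside an atomic block".
-- initShared describes the shared states produced by the init block.

record ParProg : Set₁ where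
  field
    Shared     : Set
    initShared : Shared → Set
    nProc      : ℕ
    Local      : Fin nProc → Set
    initLocal  : (p : Fin nProc) → Local p → Set
    step       : (p : Fin nProc) → Shared × Local p → Shared × Local p → Set
    atomic     : (p : Fin nProc) → Local p → Set

module _ (P : ParProg) where
  open ParProg P

  record GState (m : ℕ) (map : Fin (suc m) → Fin nProc) : Set where
    constructor gstate
    field
      active : Fin (suc m)
      shared : Shared
      locals : (t : Fin (suc m)) → Local (map t)

  open GState public

  data LocalStep {m : ℕ} {map : Fin (suc m) → Fin nProc} (i : Fin (suc m))
         : GState m map → GState m map → Set where
    lstep : ∀ {g g'} → active g ≡ i → active g' ≡ i
          → step (map i) (shared g , locals g i) (shared g' , locals g' i)
          → (∀ t → t ≢ i → locals g' t ≡ locals g t)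
          → LocalStep i g g'

  LocalReach : ∀ {m map} → Fin (suc m) → GState m map → GState m map → Set
  LocalReach i = Star (LocalStep i)

  ContextSwitch : ∀ {m map} → GState m map → GState m map → Set
  ContextSwitch {m} {map} g g' =
    active g ≢ active g' × shared g' ≡ shared g
    × (∀ t → locals g' t ≡ locals g t)
    × ¬ atomic (map (active g)) (locals g (active g))

  LinearInterface : (k : ℕ) → Vec Shared k → Vec Shared k → Set
  LinearInterface k u v =
    Σ ℕ λ m → Σ (Fin (suc m) → Fin nProc) λ map →
    Σ (Fin (suc m) → Fin k → GState m map) λ s →
    Σ (Fin (suc m) → Fin k → GState m map) λ t →
      (∀ i j → active (s i j) ≡ i × active (t i j) ≡ i)
    × (∀ j → shared (s Fin.zero j) ≡ lookup u j)
    × (∀ j → shared (t (fromℕ m) j) ≡ lookup v j)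
    × (∀ i j → LocalReach i (s i j) (t i j))
    × (∀ i j → toℕ j ≡ 0 → initLocal (map i) (locals (s i j) i))
    × (∀ i j j' → toℕ j' ≡ suc (toℕ j) → locals (s i j') i ≡ locals (t i j) i)
    × (∀ i i' j → toℕ i' ≡ suc (toℕ i)
         → shared (s i' j) ≡ shared (t i j) × ContextSwitch (t i j) (s i' j))

  -- Semantics of calls of linear_int in P^lazy_k, k = suc n.
  -- Rounds j and bounds are zero-based elements of Fin (suc n)
  -- (Fin value j stands for round j+1).  q' (the parameters
  -- q'_1..q'_{k-1}) is never modified, so it is a module parameter.
  --
  -- Run b p last q j σ s ŝ : an activation of linear_int with bound b,
  -- simulating process p, with local Boolean last, current value q of
  -- its parameters q_1..q_k, current round counter j, current local
  -- state σ of the simulated thread (pc, thread-globals g, locals,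
  -- stack of f^lazy frames) and current value s of the global shared
  -- variables, at a point where terminate = F, eventually returns with
  -- the shared variables having value ŝ.

  module Lazy (n : ℕ) (q' : Vec Shared n) where

    data Run : Fin (suc n) → (p : Fin nProc) → Bool → Vec Shared (suc n)
             → Fin (suc n) → Local p → Shared → Shared → Set where
      local : ∀ {b p last q j σ s σ' s' ŝ}
            → step p (s , σ) (s' , σ')
            → Run b p last q j σ' s' ŝ
            → Run b p last q j σ s ŝ
      -- inserted code, last = T, j = bound: terminate := T; return
      last-ret : ∀ {b p q j σ s}
            → ¬ atomic p σ → j ≡ b
            → Run b p true q j σ s s
      -- inserted code, last = T, j ≠ bound:
      -- assume(q'_j = s); j++; s := q_j
      last-next : ∀ {b p q j σ s ŝ}
            → ¬ atomic p σ → j ≢ b → (lt : toℕ j < n)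
            → lookup q' (fromℕ< lt) ≡ s
            → Run b p true q (Fin.suc (fromℕ< lt)) σ (lookup q (Fin.suc (fromℕ< lt))) ŝ
            → Run b p true q j σ s ŝ
      -- inserted code, last = F: q_j := s; save := g;
      -- call linear_int(q, q', j) (a fresh thread of some process p',
      -- initial local state σ₀, starting with s = q_1, j = 1, terminate = F)
      -- which returns with s = ŝ; then j = bound, so return
      call-ret : ∀ {b p q j σ s p' last' σ₀ ŝ}
            → ¬ atomic p σ
            → initLocal p' σ₀
            → Run j p' last' (q [ j ]≔ s) Fin.zero σ₀ (lookup (q [ j ]≔ s) Fin.zero) ŝ
            → j ≡ b
            → Run b p false q j σ s ŝ
      -- as above, but j ≠ bound: assume(q'_j = s); g := save;
      -- terminate := F; j++; s := q_j
      call-next : ∀ {b p q j σ s p' last' σ₀ s'' ŝ}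
            → ¬ atomic p σ
            → initLocal p' σ₀
            → Run j p' last' (q [ j ]≔ s) Fin.zero σ₀ (lookup (q [ j ]≔ s) Fin.zero) s''
            → j ≢ b → (lt : toℕ j < n)
            → lookup q' (fromℕ< lt) ≡ s''
            → Run b p false (q [ j ]≔ s) (Fin.suc (fromℕ< lt)) σ
                  (lookup (q [ j ]≔ s) (Fin.suc (fromℕ< lt))) ŝ
            → Run b p false q j σ s ŝ

    -- The merged process P first
    -- chooses which P_p to behave as; last is chosen nondeterministically.
    LinIntReturns : Vec Shared (suc n) → Fin (suc n) → Shared → Set
    LinIntReturns u i ŝ =
      Σ (Fin nProc) λ p → Σ Bool λ last → Σ (Local p) λ σ₀ →
        initLocal p σ₀ × Run i p last u Fin.zero σ₀ (lookup u Fin.zero) ŝ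

prefix : ∀ {A : Set} {n} (m : ℕ) → m ≤ n → Vec A n → Vec A m
prefix m le xs = tabulate (λ l → lookup xs (inject≤ l le))

-- A call of linear_int with bound i simulates one thread through rounds 1..i.  Each round is a
-- local run ending at a point where a context switch is allowed; if the thread is the last one,
-- the round ends in the guessed state v_j (or in ŝ when j = i), otherwise the state reached is
-- stored as q_j and, at the final round, a nested call with bound i simulates the remaining
-- threads starting from exactly these stored states.  Unfolding the nesting therefore yields a
-- chain of threads, each running i rounds, whose round-j outputs are the round-j inputs of the
-- next thread, and such a chain is a linear interface.

module Submission where

open import Defs
open import Data.Nat using (ℕ; suc; pred; _<_; _≤_; _≤?_; z≤n; s<s⁻¹)
open import Data.Nat.Properties
  using (<⇒≤; <⇒≢; ≤-refl; ≤-trans; ≤-reflexive; n≮n; m<1+n⇒m<n∨m≡n)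
open import Data.Fin using (Fin; toℕ; fromℕ<; inject≤)
import Data.Fin as Fin
open import Data.Fin.Properties
  using (toℕ<n; toℕ≤pred[n]; toℕ-injective; toℕ-fromℕ<; toℕ-inject≤; suc-injective; ∀-cons)
open import Data.Vec using (Vec; []; _∷_; _∷ʳ_; lookup; _[_]≔_)
open import Data.Vec.Properties using (lookup∘tabulate; lookup∘update; lookup∘update′; []≔-lookup)
open import Data.Bool using (true; false)
open import Data.Product using (Σ-syntax; _×_; _,_)
open import Function using (_∘_)
open import Data.Sum using (_⊎_; inj₁; inj₂)
open import Relation.Nullary using (¬_; yes; no; contradiction)
open import Relation.Binary.PropositionalEquality
open import Relation.Binary.Construct.Closure.ReflexiveTransitive using (Star; ε; _◅_; _◅◅_; gmap)
open import Relation.Binary.Construct.Closure.Transitive using (TransClosure; [_])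
  renaming (_∷_ to _∷⁺_)

extendAfter : ∀ {A : Set} → (ℕ → A) → ℕ → A → ℕ → A
extendAfter f d a r with r ≤? d
... | yes _ = f r
... | no _  = a

extendAfter-≤ : ∀ {A : Set} (f : ℕ → A) {d} a {r} → r ≤ d → extendAfter f d a r ≡ f r
extendAfter-≤ f {d} a {r} r≤d with r ≤? d
... | yes _  = refl
... | no r≰d = contradiction r≤d r≰d

extendAfter-suc : ∀ {A : Set} (f : ℕ → A) d a → extendAfter f d a (suc d) ≡ a
extendAfter-suc f d a with suc d ≤? d
... | yes d<d = contradiction d<d (n≮n d)
... | no _    = refl

toℕ<suc⇒<⊎≡ : ∀ {m} {r j : Fin m} → toℕ r < suc (toℕ j) → toℕ r < toℕ j ⊎ r ≡ j
toℕ<suc⇒<⊎≡ r<1+j with m<1+n⇒m<n∨m≡n r<1+j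
... | inj₁ r<j = inj₁ r<j
... | inj₂ r≡j = inj₂ (toℕ-injective r≡j)

toℕ-suc-fromℕ< : ∀ {n} {j : Fin (suc n)} (j<n : toℕ j < n)
               → toℕ (Fin.suc (fromℕ< j<n)) ≡ suc (toℕ j)
toℕ-suc-fromℕ< j<n = cong suc (toℕ-fromℕ< j<n)

lookup-prefix : ∀ {A : Set} {k} d (d≤k : d ≤ k) (xs : Vec A k) (r : Fin d)
              → lookup (prefix d d≤k xs) r ≡ lookup xs (inject≤ r d≤k)
lookup-prefix d d≤k xs = lookup∘tabulate _

lookup-∷ʳ : ∀ {A : Set} {n} (xs : Vec A n) y (j : Fin (suc n)) (j<n : toℕ j < n)
          → lookup (xs ∷ʳ y) j ≡ lookup xs (fromℕ< j<n)
lookup-∷ʳ []       y j           ()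
lookup-∷ʳ (x ∷ xs) y Fin.zero    _   = refl
lookup-∷ʳ (x ∷ xs) y (Fin.suc j) j<n = lookup-∷ʳ xs y j (s<s⁻¹ j<n)

prefix-∷ʳ-[]≔ : ∀ {A : Set} {n} (xs : Vec A n) y (b : Fin (suc n))
              → prefix (suc (toℕ b)) (toℕ<n b) ((xs ∷ʳ y) [ b ]≔ y)
                ≡ prefix (toℕ b) (toℕ≤pred[n] b) xs ∷ʳ y
prefix-∷ʳ-[]≔ []       y Fin.zero    = refl
prefix-∷ʳ-[]≔ (x ∷ xs) y Fin.zero    = refl
prefix-∷ʳ-[]≔ (x ∷ xs) y (Fin.suc b) = cong (x ∷_) (prefix-∷ʳ-[]≔ xs y b)

module Threads (P : ParProg) where
  open ParProg P

  -- localState r is the local state at the start of round r, hence also at the end of round r - 1.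
  record Rounds (p : Fin nProc) {k} (d : ℕ) (xs ys : Vec Shared k) : Set where
    field
      localState : ℕ → Local p
      initial    : initLocal p (localState 0)
      run        : ∀ (r : Fin k) → toℕ r < d
                 → Star (step p) (lookup xs r , localState (toℕ r)) (lookup ys r , localState (suc (toℕ r)))
      switchable : ∀ (r : Fin k) → toℕ r < d → ¬ atomic p (localState (suc (toℕ r)))

  weakenRounds : ∀ {p k d d′} {xs ys : Vec Shared k} → d′ ≤ d → Rounds p d xs ys → Rounds p d′ xs ys
  weakenRounds d′≤d R = record
    { localState = localState
    ; initial    = initial
    ; run        = λ r r<d′ → run r (≤-trans r<d′ d′≤d)
    ; switchable = λ r r<d′ → switchable r (≤-trans r<d′ d′≤d) }
    where open Rounds R

  Thread : ∀ k → Vec Shared k → Vec Shared k → Set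
  Thread k xs ys = Σ[ p ∈ Fin nProc ] Rounds p k xs ys

  prefixRounds : ∀ {p k d} (d≤k : d ≤ k) {xs ys : Vec Shared k}
               → Rounds p d xs ys → Rounds p d (prefix d d≤k xs) (prefix d d≤k ys)
  prefixRounds {p} {d = d} d≤k {xs} {ys} R = record
    { localState = localState ; initial = initial ; run = run′ ; switchable = switchable′ }
    where
      open Rounds R
      run′ : ∀ (r : Fin d) → toℕ r < d → Star (step p) (lookup (prefix d d≤k xs) r , localState (toℕ r))
                                              (lookup (prefix d d≤k ys) r , localState (suc (toℕ r)))
      run′ r _ = subst₂ (Star (step p))
        (cong₂ _,_ (sym (lookup-prefix d d≤k xs r)) (cong localState r≡))
        (cong₂ _,_ (sym (lookup-prefix d d≤k ys r)) (cong (localState ∘ suc) r≡))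
        (run (inject≤ r d≤k) (subst (_< d) (sym r≡) (toℕ<n r)))
        where
          r≡ : toℕ (inject≤ r d≤k) ≡ toℕ r
          r≡ = toℕ-inject≤ r d≤k
      switchable′ : ∀ (r : Fin d) → toℕ r < d → ¬ atomic p (localState (suc (toℕ r)))
      switchable′ r _ = subst (λ i → ¬ atomic p (localState (suc i))) (toℕ-inject≤ r d≤k)
        (switchable (inject≤ r d≤k) (subst (_< d) (sym (toℕ-inject≤ r d≤k)) (toℕ<n r)))

  addThread : ∀ {m} {map : Fin (suc m) → Fin nProc} {p} → Local p → GState P m map
            → GState P (suc m) (∀-cons {P = λ _ → Fin nProc} p map)
  addThread σ g = gstate (Fin.suc (active g)) (shared g) (∀-cons σ (locals g))

  addThread-localReach : ∀ {m map p} (σ : Local p) {i} {g g′ : GState P m map}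
                       → LocalReach P i g g′ → LocalReach P (Fin.suc i) (addThread σ g) (addThread σ g′)
  addThread-localReach σ = gmap (addThread σ) λ { (lstep act act′ st frame) →
    lstep (cong Fin.suc act) (cong Fin.suc act′) st λ
      { Fin.zero _ → refl
      ; (Fin.suc t) t≢i → frame t (λ t≡i → t≢i (cong Fin.suc t≡i)) } }

  addThread-contextSwitch : ∀ {m map p} (σ : Local p) {g g′ : GState P m map}
                          → ContextSwitch P g g′ → ContextSwitch P (addThread σ g) (addThread σ g′)
  addThread-contextSwitch σ (active≢ , shared≡ , locals≡ , unlocked) =
    (λ e → active≢ (suc-injective e)) , shared≡
      , (λ { Fin.zero → refl ; (Fin.suc t) → locals≡ t }) , unlocked

  localRun⇒localReach₀ : ∀ {m} {map : Fin (suc m) → Fin nProc} (others : ∀ t → Local (map (Fin.suc t)))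
    {x y σ σ′} → Star (step (map Fin.zero)) (x , σ) (y , σ′)
    → LocalReach P Fin.zero (gstate Fin.zero x (∀-cons σ others)) (gstate Fin.zero y (∀-cons σ′ others))
  localRun⇒localReach₀ {map = map} others =
    gmap (λ (x , σ) → gstate Fin.zero x (∀-cons {P = λ t → Local (map t)} σ others)) λ st →
      lstep refl refl st λ { Fin.zero 0≢0 → contradiction refl 0≢0 ; (Fin.suc t) _ → refl }

  thread⇒linearInterface : ∀ {k xs ys} → Thread k xs ys → LinearInterface P k xs ys
  thread⇒linearInterface {k} {xs} {ys} (p , R) =
    0 , (λ _ → p) , s , t , (λ { Fin.zero j → refl , refl }) , (λ j → refl) , (λ j → refl)
      , (λ { Fin.zero j → localRun⇒localReach₀ (λ ()) (run j (toℕ<n j)) })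
      , (λ { Fin.zero j j≡0 → subst (initLocal p ∘ localState) (sym j≡0) initial })
      , (λ { Fin.zero j j′ j′≡ → cong localState j′≡ })
      , λ { Fin.zero Fin.zero j () }
    where
      open Rounds R
      s t : Fin 1 → Fin k → GState P 0 (λ _ → p)
      s Fin.zero j = gstate Fin.zero (lookup xs j) (∀-cons (localState (toℕ j)) (λ ()))
      t Fin.zero j = gstate Fin.zero (lookup ys j) (∀-cons (localState (suc (toℕ j))) (λ ()))

  -- The new thread runs first in every round, while the others wait in the local states in which
  -- they begin that round; at the end of round j it switches to the first thread of the interface.
  thread-∷-linearInterface : ∀ {k xs ys zs} → Thread k xs ys → LinearInterface P k ys zs
                           → LinearInterface P k xs zs
  thread-∷-linearInterface {k} {xs} {ys} (p , R) (m , map , s , t , act , ins , outs , reach , ini , nxt , sw) =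
    suc m , map′ , s′ , t′ , act′ , (λ j → refl) , outs , reach′ , ini′ , nxt′ , sw′
    where
      open Rounds R
      map′ : Fin (suc (suc m)) → Fin nProc
      map′ = ∀-cons {P = λ _ → Fin nProc} p map
      s′ t′ : Fin (suc (suc m)) → Fin k → GState P (suc m) map′
      s′ Fin.zero    j = gstate Fin.zero (lookup xs j) (∀-cons (localState (toℕ j)) (locals (s Fin.zero j)))
      s′ (Fin.suc i) j = addThread (localState (suc (toℕ j))) (s i j)
      t′ Fin.zero    j =
        gstate Fin.zero (lookup ys j) (∀-cons (localState (suc (toℕ j))) (locals (s Fin.zero j)))
      t′ (Fin.suc i) j = addThread (localState (suc (toℕ j))) (t i j)
      act′ : ∀ i j → active (s′ i j) ≡ i × active (t′ i j) ≡ i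
      act′ Fin.zero    j = refl , refl
      act′ (Fin.suc i) j with act i j
      ... | s≡ , t≡ = cong Fin.suc s≡ , cong Fin.suc t≡
      reach′ : ∀ i j → LocalReach P i (s′ i j) (t′ i j)
      reach′ Fin.zero    j = localRun⇒localReach₀ (locals (s Fin.zero j)) (run j (toℕ<n j))
      reach′ (Fin.suc i) j = addThread-localReach _ (reach i j)
      ini′ : ∀ i j → toℕ j ≡ 0 → initLocal (map′ i) (locals (s′ i j) i)
      ini′ Fin.zero    j j≡0 = subst (λ d → initLocal p (localState d)) (sym j≡0) initial
      ini′ (Fin.suc i) j j≡0 = ini i j j≡0
      nxt′ : ∀ i j j′ → toℕ j′ ≡ suc (toℕ j) → locals (s′ i j′) i ≡ locals (t′ i j) i
      nxt′ Fin.zero    j j′ j′≡ = cong localState j′≡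
      nxt′ (Fin.suc i) j j′ j′≡ = nxt i j j′ j′≡
      sw′ : ∀ i i′ j → toℕ i′ ≡ suc (toℕ i)
          → shared (s′ i′ j) ≡ shared (t′ i j) × ContextSwitch P (t′ i j) (s′ i′ j)
      sw′ _           Fin.zero                j ()
      sw′ Fin.zero    (Fin.suc Fin.zero)      j _  =
        ins j , (λ ()) , ins j , (λ { Fin.zero → refl ; (Fin.suc _) → refl }) , switchable j (toℕ<n j)
      sw′ Fin.zero    (Fin.suc (Fin.suc _))   j ()
      sw′ (Fin.suc i) (Fin.suc i′)            j i′≡ with sw i i′ j (cong pred i′≡)
      ... | shared≡ , switch = shared≡ , addThread-contextSwitch _ switch

  chain⇒linearInterface : ∀ {k xs ys} → TransClosure (Thread k) xs ys → LinearInterface P k xs ys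
  chain⇒linearInterface [ th ] = thread⇒linearInterface th
  chain⇒linearInterface {ys = zs} (_∷⁺_ {y = ys} th ch) =
    thread-∷-linearInterface {ys = ys} {zs} th (chain⇒linearInterface ch)

module LazyRuns (P : ParProg) (n : ℕ) (v : Vec (ParProg.Shared P) n) where
  open ParProg P
  open Lazy P n v
  open Threads P

  Round : Set
  Round = Fin (suc n)

  record Progress (p : Fin nProc) (xs ys : Vec Shared (suc n)) (j : Round) (s : Shared) (σ : Local p)
         : Set where
    field
      done    : Rounds p (toℕ j) xs ys
      current : Star (step p) (lookup xs j , Rounds.localState done (toℕ j)) (s , σ)

  fresh : ∀ {p σ₀ xs ys} → initLocal p σ₀ → Progress p xs ys Fin.zero (lookup xs Fin.zero) σ₀
  fresh {σ₀ = σ₀} init = record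
    { done    = record { localState = λ _ → σ₀ ; initial = init ; run = λ _ () ; switchable = λ _ () }
    ; current = ε }

  progress-step : ∀ {p xs ys j s σ s′ σ′} → Progress p xs ys j s σ → step p (s , σ) (s′ , σ′)
                → Progress p xs ys j s′ σ′
  progress-step Π st = record { done = done ; current = current ◅◅ (st ◅ ε) }
    where open Progress Π

  endRound : ∀ {p xs ys j s σ} → Progress p xs ys j s σ → ¬ atomic p σ
           → Rounds p (suc (toℕ j)) xs (ys [ j ]≔ s)
  endRound {p} {xs} {ys} {j} {s} {σ} Π unlocked = record
    { localState = localState′ ; initial = initial′ ; run = run′ ; switchable = switchable′ }
    where
      open Progress Π
      open Rounds done
      localState′ : ℕ → Local p
      localState′ = extendAfter localState (toℕ j) σ
      initial′ : initLocal p (localState′ 0)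
      initial′ = subst (initLocal p) (sym (extendAfter-≤ localState {toℕ j} σ z≤n)) initial
      run′ : ∀ r → toℕ r < suc (toℕ j)
           → Star (step p) (lookup xs r , localState′ (toℕ r))
                           (lookup (ys [ j ]≔ s) r , localState′ (suc (toℕ r)))
      run′ r r<1+j with toℕ<suc⇒<⊎≡ r<1+j
      ... | inj₁ r<j = subst₂ (Star (step p))
        (cong (lookup xs r ,_) (sym (extendAfter-≤ localState σ (<⇒≤ r<j))))
        (cong₂ _,_ (sym (lookup∘update′ (λ r≡j → <⇒≢ r<j (cong toℕ r≡j)) ys s))
                   (sym (extendAfter-≤ localState σ r<j)))
        (run r r<j)
      ... | inj₂ refl = subst₂ (Star (step p))
        (cong (lookup xs j ,_) (sym (extendAfter-≤ localState σ ≤-refl)))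
        (cong₂ _,_ (sym (lookup∘update j ys s)) (sym (extendAfter-suc localState (toℕ j) σ)))
        current
      switchable′ : ∀ r → toℕ r < suc (toℕ j) → ¬ atomic p (localState′ (suc (toℕ r)))
      switchable′ r r<1+j with toℕ<suc⇒<⊎≡ r<1+j
      ... | inj₁ r<j  = subst (¬_ ∘ atomic p) (sym (extendAfter-≤ localState σ r<j)) (switchable r r<j)
      ... | inj₂ refl = subst (¬_ ∘ atomic p) (sym (extendAfter-suc localState (toℕ j) σ)) unlocked

  nextRound : ∀ {p xs ys j s σ} → Progress p xs ys j s σ → ¬ atomic p σ → (j<n : toℕ j < n)
            → Progress p xs (ys [ j ]≔ s) (Fin.suc (fromℕ< j<n)) (lookup xs (Fin.suc (fromℕ< j<n))) σ
  nextRound {p} {xs} {ys} {j} {s} {σ} Π unlocked j<n = record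
    { done    = weakenRounds (≤-reflexive j⁺≡) (endRound Π unlocked)
    ; current = subst (λ σ′ → Star (step p) (_ , σ′) (_ , σ))
                      (sym (trans (cong localState′ j⁺≡) (extendAfter-suc localState (toℕ j) σ))) ε }
    where
      open Rounds (Progress.done Π)
      j⁺≡ : toℕ (Fin.suc (fromℕ< j<n)) ≡ suc (toℕ j)
      j⁺≡ = toℕ-suc-fromℕ< j<n
      localState′ : ℕ → Local p
      localState′ = extendAfter localState (toℕ j) σ

  AgreeFrom : ℕ → Vec Shared (suc n) → Vec Shared (suc n) → Set
  AgreeFrom d q q₀ = ∀ r → d ≤ toℕ r → lookup q r ≡ lookup q₀ r

  agreeFrom-update : ∀ {j : Round} {q q₀} s → AgreeFrom (toℕ j) q q₀
                   → AgreeFrom (suc (toℕ j)) (q [ j ]≔ s) q₀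
  agreeFrom-update {j} {q} s agree r j<r =
    trans (lookup∘update′ (λ r≡j → <⇒≢ j<r (cong toℕ (sym r≡j))) q s) (agree r (<⇒≤ j<r))

  Chain : Round → Shared → Vec Shared (suc n) → Set
  Chain b ŝ xs = TransClosure (Thread (suc (toℕ b)))
                   (prefix (suc (toℕ b)) (toℕ<n b) xs) (prefix (toℕ b) (toℕ≤pred[n] b) v ∷ʳ ŝ)

  thread : ∀ {p} {b : Round} {xs ys} → Rounds p (suc (toℕ b)) xs ys
         → Thread (suc (toℕ b)) (prefix (suc (toℕ b)) (toℕ<n b) xs) (prefix (suc (toℕ b)) (toℕ<n b) ys)
  thread {p} {b} R = p , prefixRounds (toℕ<n b) R

  mutual
    runChain : ∀ {b p last q σ₀ ŝ} → initLocal p σ₀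
             → Run b p last q Fin.zero σ₀ (lookup q Fin.zero) ŝ
             → Chain b ŝ q
    runChain {last = true}  init r = lastThread r (fresh init)
    runChain {last = false} {q} init r = innerThread r (fresh {xs = q} {q} init) (λ _ _ → refl)

    -- The last thread's outputs are read off v ∷ʳ ŝ, which already holds the guess v_j checked
    -- at the end of every round j < b.
    lastThread : ∀ {b p q j σ s ŝ} → Run b p true q j σ s ŝ → Progress p q (v ∷ʳ ŝ) j s σ
               → Chain b ŝ q
    lastThread (local st r) Π = lastThread r (progress-step Π st)
    lastThread {b} {p} {q} {s = s} (last-ret unlocked refl) Π =
      [ subst (Thread _ _) (prefix-∷ʳ-[]≔ v s b) (thread {b = b} (endRound Π unlocked)) ]
    lastThread {p = p} {q} {j} {s = s} {ŝ} (last-next unlocked _ j<n v≡s r) Π =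
      lastThread r (subst (λ ys → Progress p q ys _ _ _) outputs-unchanged (nextRound Π unlocked j<n))
      where
        outputs-unchanged : (v ∷ʳ ŝ) [ j ]≔ s ≡ v ∷ʳ ŝ
        outputs-unchanged = trans (cong ((v ∷ʳ ŝ) [ j ]≔_) (sym (trans (lookup-∷ʳ v ŝ j j<n) v≡s)))
                                  ([]≔-lookup (v ∷ʳ ŝ) j)

    -- A nested call made before the final round is discarded: the threads it simulates only run
    -- the first j rounds, while the call made in the final round simulates all of them.
    innerThread : ∀ {b p q₀ q j σ s ŝ} → Run b p false q j σ s ŝ → Progress p q₀ q j s σ
                → AgreeFrom (toℕ j) q q₀ → Chain b ŝ q₀
    innerThread (local st r) Π agree = innerThread r (progress-step Π st) agree
    innerThread {b} (call-ret unlocked init r refl) Π _ =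
      thread {b = b} (endRound Π unlocked) ∷⁺ runChain init r
    innerThread {p = p} {q₀} {q} {j} {σ} {s} (call-next unlocked _ _ _ j<n _ r) Π agree =
      innerThread r (subst (λ x → Progress p q₀ (q [ j ]≔ s) j⁺ x σ) (sym (agree′ j⁺ ≤-refl))
                           (nextRound Π unlocked j<n))
                    agree′
      where
        j⁺ : Round
        j⁺ = Fin.suc (fromℕ< j<n)
        agree′ : AgreeFrom (toℕ j⁺) (q [ j ]≔ s) q₀
        agree′ = subst (λ d → AgreeFrom d (q [ j ]≔ s) q₀) (sym (toℕ-suc-fromℕ< j<n))
                       (agreeFrom-update {j} {q} {q₀} s agree)

lemma2 : (P : ParProg) (n : ℕ) (u : Vec (ParProg.Shared P) (suc n))
    (v : Vec (ParProg.Shared P) n) (i : Fin (suc n)) (ŝ : ParProg.Shared P)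
    → Lazy.LinIntReturns P n v u i ŝ
    → LinearInterface P (suc (toℕ i)) (prefix (suc (toℕ i)) (toℕ<n i) u)
    (prefix (toℕ i) (toℕ≤pred[n] i) v ∷ʳ ŝ)
lemma2 P n u v i ŝ (_ , _ , _ , init , r) =
  Threads.chain⇒linearInterface P (LazyRuns.runChain P n v init r)
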